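{- The logic $Ax_{\mathsf{MBCL}}^{\mathsf{CUDL}}$ is decidable: there is an algorithm that, given a formula $A$ of $\mathcal{L}_{\mathsf{MBCL}}$, decides whether $\vdash_{Ax_{\mathsf{MBCL}}^{\mathsf{CUDL}}}A$.
   Context: $\mathcal{L}_{\mathsf{MBCL}}$: variables $p_0,p_1,\dots$, unary $\neg,\Box,\Diamond$, binary $\wedge,\vee,\rightarrow$. $A\supset B:=\neg A\vee B$, $A\equiv B:=(\neg A\vee B)\wedge(\neg B\vee A)$. Demodalization $d$: $d(p)=p$, $d(\neg A)=\neg d(A)$, $d(A\star B)=d(A)\star d(B)$ for $\star\in\{\wedge,\vee,\rightarrow\}$, $d(\Box A)=d(\Diamond A)=d(A)$. $Ax_{\mathsf{MBCL}}^{\mathsf{CUDL}}$ has axiom schemata: substitution instances of classical tautologies; $\neg(A\rightarrow\neg A)$; $\neg(\neg A\rightarrow A)$; $(A\rightarrow B)\rightarrow\neg(A\rightarrow\neg B)$; $(A\rightarrow\neg B)\rightarrow\neg(A\rightarrow B)$; $(A\rightarrow B)\supset(A\supset B)$; $\Diamond A\equiv\neg\Box\neg A$; $\Box(A\supset B)\supset(\Box A\supset\Box B)$; $(d(A)\rightarrow d(B))\supset((A\rightarrow B)\vee(A\wedge\neg B))$; rules: from $A$ and $A\supset B$ infer $B$; from a theorem $A$ infer $\Box A$. -}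

module Defs where

open import Data.Nat using (ℕ)
open import Data.Bool using (Bool; true; not; _∧_; _∨_)
open import Relation.Binary.PropositionalEquality using (_≡_)

infixr 4 _⇒_
infixr 5 _∨ᶠ_
infixr 6 _∧ᶠ_

data Fml : Set where
  var  : ℕ → Fml
  ¬ᶠ_  : Fml → Fml
  □_   : Fml → Fml
  ◇_   : Fml → Fml
  _∧ᶠ_ : Fml → Fml → Fml
  _∨ᶠ_ : Fml → Fml → Fml
  _⇒_  : Fml → Fml → Fml

_⊃_ : Fml → Fml → Fml
A ⊃ B = (¬ᶠ A) ∨ᶠ B

_≣_ : Fml → Fml → Fml
A ≣ B = ((¬ᶠ A) ∨ᶠ B) ∧ᶠ ((¬ᶠ B) ∨ᶠ A)

d : Fml → Fml
d (var p)  = var p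
d (¬ᶠ A)   = ¬ᶠ d A
d (□ A)    = d A
d (◇ A)    = d A
d (A ∧ᶠ B) = d A ∧ᶠ d B
d (A ∨ᶠ B) = d A ∨ᶠ d B
d (A ⇒ B)  = d A ⇒ d B

data CFml : Set where
  cvar : ℕ → CFml
  cneg : CFml → CFml
  cand : CFml → CFml → CFml
  cor  : CFml → CFml → CFml

eval : (ℕ → Bool) → CFml → Bool
eval v (cvar p)   = v p
eval v (cneg T)   = not (eval v T)
eval v (cand T U) = eval v T ∧ eval v U
eval v (cor T U)  = eval v T ∨ eval v U

Tautology : CFml → Set
Tautology T = (v : ℕ → Bool) → eval v T ≡ true

inst : (ℕ → Fml) → CFml → Fml
inst σ (cvar p)   = σ p
inst σ (cneg T)   = ¬ᶠ inst σ T
inst σ (cand T U) = inst σ T ∧ᶠ inst σ U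
inst σ (cor T U)  = inst σ T ∨ᶠ inst σ U

data ⊢_ : Fml → Set where
  taut  : (T : CFml) (σ : ℕ → Fml) → Tautology T → ⊢ inst σ T
  ax1   : (A : Fml) → ⊢ ¬ᶠ (A ⇒ ¬ᶠ A)
  ax2   : (A : Fml) → ⊢ ¬ᶠ ((¬ᶠ A) ⇒ A)
  ax3   : (A B : Fml) → ⊢ ((A ⇒ B) ⇒ ¬ᶠ (A ⇒ ¬ᶠ B))
  ax4   : (A B : Fml) → ⊢ ((A ⇒ ¬ᶠ B) ⇒ ¬ᶠ (A ⇒ B))
  ax5   : (A B : Fml) → ⊢ ((A ⇒ B) ⊃ (A ⊃ B))
  axDia : (A : Fml) → ⊢ ((◇ A) ≣ (¬ᶠ (□ (¬ᶠ A))))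
  axK   : (A B : Fml) → ⊢ ((□ (A ⊃ B)) ⊃ ((□ A) ⊃ (□ B)))
  axD   : (A B : Fml) → ⊢ ((d A ⇒ d B) ⊃ ((A ⇒ B) ∨ᶠ (A ∧ᶠ ¬ᶠ B)))
  mp    : {A B : Fml} → ⊢ A → ⊢ (A ⊃ B) → ⊢ B
  nec   : {A : Fml} → ⊢ A → ⊢ (□ A)

-- Decidability is proved through a constructive finite model property, by induction on modal depth.
-- Formulas are evaluated in finite trees whose nodes interpret → by an arbitrary function subject only
-- to the connexive axioms, and the logic is sound for such trees. For A, run through all assignments L
-- of truth values to the atoms of a finite closure of A, which contains d X ⇒ d Y along with X ⇒ Y.
-- Either A is true under L, or L falsifies an axiom instance over the closure, or some formula of
-- lower depth forced by the modal atoms is provable; in each case ⊢ conj L ⊃ A, by Kalmar's lemma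
-- (and K in the last case). Otherwise the countermodels of those lower-depth formulas become the
-- children of a node refuting A, whose arrow is extended beyond the closure so that every axiom holds;
-- the extension works because L was also checked to make X ⇒ Y and X ⇒ ¬ Y mutually exclusive.
-- If no assignment leads to a countermodel, the case split over all of them proves A.

module Submission where

open import Defs
open import Relation.Nullary using (Dec)

open import Data.Bool as Bool using (Bool; true; false; not; _∧_; _∨_; if_then_else_)
open import Data.Bool.Properties
  using ( ∧-conicalˡ; ∧-conicalʳ; ∧-zeroʳ; ∨-conicalˡ; ∨-conicalʳ; ∨-inverseˡ
        ; ¬-not; not-injective; not-involutive; T-≡)
open import Data.Empty using (⊥-elim)
open import Data.List as List using (List; []; _∷_; _++_)
open import Data.List.Membership.Propositional using (_∈_; find; lose)
open import Data.List.Membership.Propositional.Properties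
  using (∈-++⁺ˡ; ∈-++⁺ʳ; ∈-++⁻; ∈-concatMap⁺; ∈-concatMap⁻)
open import Data.List.Relation.Binary.Permutation.Propositional using (↭-sym)
open import Data.List.Relation.Binary.Permutation.Propositional.Properties using (shift)
open import Data.List.Relation.Binary.Subset.Propositional using (_⊆_)
open import Data.List.Relation.Binary.Subset.Propositional.Properties
  using (⊆-trans; xs⊆xs++ys; xs⊆ys++xs; ++⁺; ∈-∷⁺ʳ; ⊆-reflexive-↭)
open import Data.List.Relation.Unary.All as All using (All; []; _∷_)
open import Data.List.Relation.Unary.Any using (Any; here; there)
open import Data.Nat as ℕ using (ℕ; zero; suc; _<_; _⊔_; s≤s; z≤n)
open import Data.Nat.Properties
  using (≤-refl; <-≤-trans; ≤-<-trans; m≤m⊔n; m≤n⊔m; m<n⇒m<n⊔o; m<n⇒m<o⊔n; ⊔-pres-<m)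
open import Data.Product as Product using (Σ-syntax; _×_; _,_; proj₁)
open import Data.Sum as Sum using (_⊎_; inj₁; inj₂)
open import Data.Unit using (⊤; tt)
open import Function using (_∘_; flip)
open import Function.Bundles using (Equivalence)
open import Relation.Binary.Definitions using (DecidableEquality)
open import Relation.Binary.PropositionalEquality
  using (_≡_; _≢_; refl; sym; trans; cong; cong₂; subst; module ≡-Reasoning)
open import Relation.Nullary using (yes; no; ¬_; does)
open import Relation.Nullary.Decidable using (map′; _×-dec_; _⊎-dec_; dec-true; dec-false)

open ≡-Reasoning

data Code : Set where
  leaf : ℕ → Code
  node : ℕ → Code → Code → Code

infix 4 _≟ᶜ_ _≟_

_≟ᶜ_ : DecidableEquality Code
leaf m ≟ᶜ leaf n = map′ (cong leaf) (λ { refl → refl }) (m ℕ.≟ n)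
leaf _ ≟ᶜ node _ _ _ = no λ ()
node _ _ _ ≟ᶜ leaf _ = no λ ()
node i a b ≟ᶜ node j c e =
  map′ (λ { (refl , refl , refl) → refl }) (λ { refl → refl , refl , refl })
       (i ℕ.≟ j ×-dec a ≟ᶜ c ×-dec b ≟ᶜ e)

encode : Fml → Code
encode (var p)  = leaf p
encode (¬ᶠ A)   = node 0 (encode A) (leaf 0)
encode (□ A)    = node 1 (encode A) (leaf 0)
encode (◇ A)    = node 2 (encode A) (leaf 0)
encode (A ∧ᶠ B) = node 3 (encode A) (encode B)
encode (A ∨ᶠ B) = node 4 (encode A) (encode B)
encode (A ⇒ B)  = node 5 (encode A) (encode B)

decode : Code → Fml
decode (leaf p)     = var p
decode (node 0 a _) = ¬ᶠ decode a
decode (node 1 a _) = □ decode a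
decode (node 2 a _) = ◇ decode a
decode (node 3 a b) = decode a ∧ᶠ decode b
decode (node 4 a b) = decode a ∨ᶠ decode b
decode (node _ a b) = decode a ⇒ decode b

decode-encode : ∀ A → decode (encode A) ≡ A
decode-encode (var p)  = refl
decode-encode (¬ᶠ A)   = cong ¬ᶠ_ (decode-encode A)
decode-encode (□ A)    = cong □_ (decode-encode A)
decode-encode (◇ A)    = cong ◇_ (decode-encode A)
decode-encode (A ∧ᶠ B) = cong₂ _∧ᶠ_ (decode-encode A) (decode-encode B)
decode-encode (A ∨ᶠ B) = cong₂ _∨ᶠ_ (decode-encode A) (decode-encode B)
decode-encode (A ⇒ B)  = cong₂ _⇒_ (decode-encode A) (decode-encode B)

encode-injective : ∀ {A B} → encode A ≡ encode B → A ≡ B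
encode-injective {A} {B} eq =
  trans (sym (decode-encode A)) (trans (cong decode eq) (decode-encode B))

_≟_ : DecidableEquality Fml
A ≟ B = map′ encode-injective (cong encode) (encode A ≟ᶜ encode B)

open import Data.List.Membership.DecPropositional _≟_ using (_∈?_)


-- Tautologies, checked by truth tables

-- A classical formula is a tautology as soon as it holds under the finitely many valuations
-- of the variables below its variable bound (all later variables set to false).

_∷ᵛ_ : Bool → (ℕ → Bool) → ℕ → Bool
(b ∷ᵛ v) zero    = b
(b ∷ᵛ v) (suc i) = v i

allValuations : ℕ → ((ℕ → Bool) → Bool) → Bool
allValuations zero    P = P (λ _ → false)
allValuations (suc n) P = allValuations n (λ v → P (true ∷ᵛ v)) ∧ allValuations n (λ v → P (false ∷ᵛ v))

allValuations-sound : ∀ n P → allValuations n P ≡ true →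
                      ∀ (v : ℕ → Bool) → Σ[ w ∈ (ℕ → Bool) ] (∀ i → i < n → w i ≡ v i) × P w ≡ true
allValuations-sound zero    P h v = (λ _ → false) , (λ _ ()) , h
allValuations-sound (suc n) P h v =
  let w , w≈v , Pw = allValuations-sound n (λ u → P (v 0 ∷ᵛ u)) (branch (v 0)) (λ i → v (suc i))
  in (v 0 ∷ᵛ w) , agree w w≈v , Pw
  where
    branch : ∀ b → allValuations n (λ u → P (b ∷ᵛ u)) ≡ true
    branch true  = ∧-conicalˡ _ _ h
    branch false = ∧-conicalʳ _ _ h
    agree : ∀ w → (∀ i → i < n → w i ≡ v (suc i)) → ∀ i → i < suc n → (v 0 ∷ᵛ w) i ≡ v i
    agree w w≈v zero    _         = refl
    agree w w≈v (suc i) (s≤s i<n) = w≈v i i<n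

varBound : CFml → ℕ
varBound (cvar p)   = suc p
varBound (cneg T)   = varBound T
varBound (cand T U) = varBound T ⊔ varBound U
varBound (cor T U)  = varBound T ⊔ varBound U

eval-cong : ∀ T {v w} → (∀ i → i < varBound T → v i ≡ w i) → eval v T ≡ eval w T
eval-cong (cvar p)   h = h p ≤-refl
eval-cong (cneg T)   h = cong not (eval-cong T h)
eval-cong (cand T U) h = cong₂ _∧_ (eval-cong T (λ i i< → h i (<-≤-trans i< (m≤m⊔n _ _))))
                                   (eval-cong U (λ i i< → h i (<-≤-trans i< (m≤n⊔m _ _))))
eval-cong (cor T U)  h = cong₂ _∨_ (eval-cong T (λ i i< → h i (<-≤-trans i< (m≤m⊔n _ _))))
                                   (eval-cong U (λ i i< → h i (<-≤-trans i< (m≤n⊔m _ _))))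

truthTable : CFml → Bool
truthTable T = allValuations (varBound T) (λ v → eval v T)

truthTable-sound : ∀ T → truthTable T ≡ true → Tautology T
truthTable-sound T h v =
  let w , w≈v , ok = allValuations-sound (varBound T) (λ v → eval v T) h v
  in trans (eval-cong T λ i i< → sym (w≈v i i<)) ok

_!_ : List Fml → ℕ → Fml
(A ∷ _)  ! zero  = A
(_ ∷ As) ! suc i = As ! i
[]       ! _     = var 0

tautology : (T : CFml) (As : List Fml) → {Bool.T (truthTable T)} → ⊢ inst (As !_) T
tautology T As {h} = taut T (As !_) (truthTable-sound T (Equivalence.to T-≡ h))

infix 7 ¬ᶜ_
infixr 4 _⊃ᶜ_
infixr 6 _∧ᶜ_
infixr 5 _∨ᶜ_
infix 4 _≣ᶜ_

¬ᶜ_ : CFml → CFml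
¬ᶜ_ = cneg

_⊃ᶜ_ _∧ᶜ_ _∨ᶜ_ : CFml → CFml → CFml
a ⊃ᶜ b = cor (cneg a) b
a ∧ᶜ b = cand a b
a ∨ᶜ b = cor a b

_≣ᶜ_ : CFml → CFml → CFml
a ≣ᶜ b = (a ⊃ᶜ b) ∧ᶜ (b ⊃ᶜ a)

p₀ p₁ p₂ p₃ : CFml
p₀ = cvar 0
p₁ = cvar 1
p₂ = cvar 2
p₃ = cvar 3


⊃-trans : ∀ {X Y Z} → ⊢ (X ⊃ Y) → ⊢ (Y ⊃ Z) → ⊢ (X ⊃ Z)
⊃-trans {X} {Y} {Z} p q = mp q (mp p (tautology ((p₀ ⊃ᶜ p₁) ⊃ᶜ (p₁ ⊃ᶜ p₂) ⊃ᶜ p₀ ⊃ᶜ p₂) (X ∷ Y ∷ Z ∷ [])))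

⊃-cases : ∀ {X C A} → ⊢ ((X ∧ᶠ C) ⊃ A) → ⊢ (((¬ᶠ X) ∧ᶠ C) ⊃ A) → ⊢ (C ⊃ A)
⊃-cases {X} {C} {A} ⊢X ⊢¬X =
  mp ⊢¬X (mp ⊢X (tautology ((p₀ ∧ᶜ p₁ ⊃ᶜ p₂) ⊃ᶜ (¬ᶜ p₀ ∧ᶜ p₁ ⊃ᶜ p₂) ⊃ᶜ p₁ ⊃ᶜ p₂) (X ∷ C ∷ A ∷ [])))

⊤ᶠ : Fml
⊤ᶠ = var 0 ∨ᶠ (¬ᶠ var 0)

⊢⊤ᶠ : ⊢ ⊤ᶠ
⊢⊤ᶠ = tautology (p₀ ∨ᶜ ¬ᶜ p₀) (var 0 ∷ [])

⋀ : List Fml → Fml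
⋀ []       = ⊤ᶠ
⋀ (A ∷ As) = A ∧ᶠ ⋀ As

□-mono : ∀ {X Y} → ⊢ (X ⊃ Y) → ⊢ ((□ X) ⊃ (□ Y))
□-mono {X} {Y} ⊢X⊃Y = mp (nec ⊢X⊃Y) (axK X Y)

□⋀-⊢ : ∀ {C} As → (∀ {A} → A ∈ As → ⊢ (C ⊃ (□ A))) → ⊢ (C ⊃ (□ (⋀ As)))
□⋀-⊢ {C} [] _ = mp (nec ⊢⊤ᶠ) (tautology (p₁ ⊃ᶜ p₀ ⊃ᶜ p₁) (C ∷ □ ⊤ᶠ ∷ []))
□⋀-⊢ {C} (A ∷ As) h =
  mp (⊃-trans (□-mono (tautology (p₀ ⊃ᶜ p₁ ⊃ᶜ p₀ ∧ᶜ p₁) (A ∷ ⋀ As ∷ []))) (axK (⋀ As) (A ∧ᶠ ⋀ As)))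
    (mp (□⋀-⊢ As (h ∘ there)) (mp (h (here refl))
      (tautology ((p₀ ⊃ᶜ p₁) ⊃ᶜ (p₀ ⊃ᶜ p₂) ⊃ᶜ (p₁ ⊃ᶜ p₂ ⊃ᶜ p₃) ⊃ᶜ p₀ ⊃ᶜ p₃)
                 (C ∷ □ A ∷ □ (⋀ As) ∷ □ (A ∧ᶠ ⋀ As) ∷ []))))


-- Aristotle's and Boethius' theses

d-idempotent : ∀ A → d (d A) ≡ d A
d-idempotent (var p)  = refl
d-idempotent (¬ᶠ A)   = cong ¬ᶠ_ (d-idempotent A)
d-idempotent (□ A)    = d-idempotent A
d-idempotent (◇ A)    = d-idempotent A
d-idempotent (A ∧ᶠ B) = cong₂ _∧ᶠ_ (d-idempotent A) (d-idempotent B)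
d-idempotent (A ∨ᶠ B) = cong₂ _∨ᶠ_ (d-idempotent A) (d-idempotent B)
d-idempotent (A ⇒ B)  = cong₂ _⇒_ (d-idempotent A) (d-idempotent B)

data Contradictory : Fml → Fml → Set where
  negation   : ∀ A → Contradictory A (¬ᶠ A)
  unnegation : ∀ A → Contradictory (¬ᶠ A) A

-- The antecedents and consequents of Boethius' theses (axioms 3 and 4).
data Boethius : Fml → Fml → Set where
  boethius : ∀ A {B C} → Contradictory B C → Boethius (A ⇒ B) (¬ᶠ (A ⇒ C))

Contradictory? : ∀ X Y → Dec (Contradictory X Y)
Contradictory? X Y with Y ≟ ¬ᶠ X | X ≟ ¬ᶠ Y
... | yes refl | _        = yes (negation X)
... | no _     | yes refl = yes (unnegation Y)
... | no X≢¬Y  | no Y≢¬X  = no λ { (negation _) → X≢¬Y refl ; (unnegation _) → Y≢¬X refl }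

Boethius? : ∀ X Y → Dec (Boethius X Y)
Boethius? (A ⇒ B) (¬ᶠ (A′ ⇒ C)) =
  map′ (λ { (refl , c) → boethius A c }) (λ { (boethius _ c) → refl , c }) (A ≟ A′ ×-dec Contradictory? B C)
Boethius? (var _)  _ = no λ ()
Boethius? (¬ᶠ _)   _ = no λ ()
Boethius? (□ _)    _ = no λ ()
Boethius? (◇ _)    _ = no λ ()
Boethius? (_ ∧ᶠ _) _ = no λ ()
Boethius? (_ ∨ᶠ _) _ = no λ ()
Boethius? (_ ⇒ _) (var _)         = no λ ()
Boethius? (_ ⇒ _) (□ _)           = no λ ()
Boethius? (_ ⇒ _) (◇ _)           = no λ ()
Boethius? (_ ⇒ _) (_ ∧ᶠ _)        = no λ ()
Boethius? (_ ⇒ _) (_ ∨ᶠ _)        = no λ ()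
Boethius? (_ ⇒ _) (_ ⇒ _)         = no λ ()
Boethius? (_ ⇒ _) (¬ᶠ var _)      = no λ ()
Boethius? (_ ⇒ _) (¬ᶠ ¬ᶠ _)       = no λ ()
Boethius? (_ ⇒ _) (¬ᶠ □ _)        = no λ ()
Boethius? (_ ⇒ _) (¬ᶠ ◇ _)        = no λ ()
Boethius? (_ ⇒ _) (¬ᶠ (_ ∧ᶠ _))   = no λ ()
Boethius? (_ ⇒ _) (¬ᶠ (_ ∨ᶠ _))   = no λ ()

contradictory-irreflexive : ∀ {A} → ¬ Contradictory A A
contradictory-irreflexive ()

contradictory-¬boethius : ∀ {X Y} → Contradictory X Y → ¬ Boethius X Y
contradictory-¬boethius (negation _) (boethius _ c) = contradictory-irreflexive c

contradictory-sym : ∀ {Y Z} → Contradictory Y Z → Contradictory Z Y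
contradictory-sym (negation A)   = unnegation A
contradictory-sym (unnegation A) = negation A

boethius-boethius-¬contradictory : ∀ {X Y Z} → Boethius X Y → Boethius X Z → ¬ Contradictory Y Z
boethius-boethius-¬contradictory (boethius _ _) (boethius _ _) ()

contradictory-d : ∀ {X Y} → Contradictory X Y → Contradictory (d X) (d Y)
contradictory-d (negation A)   = negation (d A)
contradictory-d (unnegation A) = unnegation (d A)

boethius-d : ∀ {X Y} → Boethius X Y → Boethius (d X) (d Y)
boethius-d (boethius A c) = boethius (d A) (contradictory-d c)

aristotle-⊢ : ∀ {X Y} → Contradictory X Y → ⊢ ¬ᶠ (X ⇒ Y)
aristotle-⊢ (negation A)   = ax1 A
aristotle-⊢ (unnegation A) = ax2 A

boethius-⊢ : ∀ {X Y} → Boethius X Y → ⊢ (X ⇒ Y)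
boethius-⊢ (boethius A (negation B))   = ax3 A B
boethius-⊢ (boethius A (unnegation C)) = ax4 A C

exclusion-⊢ : ∀ A {B C} → Contradictory B C → ⊢ ((A ⇒ B) ⊃ (¬ᶠ (A ⇒ C)))
exclusion-⊢ A c = mp (boethius-⊢ (boethius A c)) (ax5 _ _)

exclusion-d-⊢ : ∀ X {Y Z} → Contradictory Y Z → ⊢ (((X ⇒ Y) ∧ᶠ (d X ⇒ d Z)) ⊃ (X ∧ᶠ (¬ᶠ Z)))
exclusion-d-⊢ X {Y} {Z} c =
  mp (axD X Z) (mp (exclusion-⊢ X c)
    (tautology ((p₀ ⊃ᶜ ¬ᶜ p₁) ⊃ᶜ (p₃ ⊃ᶜ p₁ ∨ᶜ p₂) ⊃ᶜ p₀ ∧ᶜ p₃ ⊃ᶜ p₂)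
               ((X ⇒ Y) ∷ (X ⇒ Z) ∷ (X ∧ᶠ (¬ᶠ Z)) ∷ (d X ⇒ d Z) ∷ [])))

contradictories : Fml → List Fml
contradictories Y = (¬ᶠ Y) ∷ unnegations Y
  where
    unnegations : Fml → List Fml
    unnegations (¬ᶠ Y) = Y ∷ []
    unnegations _      = []

contradictory-∈ : ∀ {Y Z} → Contradictory Y Z → Z ∈ contradictories Y
contradictory-∈ (negation _)   = here refl
contradictory-∈ (unnegation _) = there (here refl)


-- Closure and modal depth

atoms : Fml → List Fml
atoms (var p)  = var p ∷ []
atoms (¬ᶠ A)   = atoms A
atoms (□ A)    = □ A ∷ []
atoms (◇ A)    = ◇ A ∷ []
atoms (A ∧ᶠ B) = atoms A ++ atoms B
atoms (A ∨ᶠ B) = atoms A ++ atoms B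
atoms (A ⇒ B)  = (A ⇒ B) ∷ []

demodClosure : Fml → List Fml
demodClosure (var p)  = var p ∷ []
demodClosure (¬ᶠ A)   = demodClosure A
demodClosure (□ A)    = demodClosure A
demodClosure (◇ A)    = demodClosure A
demodClosure (A ∧ᶠ B) = demodClosure A ++ demodClosure B
demodClosure (A ∨ᶠ B) = demodClosure A ++ demodClosure B
demodClosure (A ⇒ B)  = (d A ⇒ d B) ∷ demodClosure A ++ demodClosure B

closure : Fml → List Fml
closure (var p)  = var p ∷ []
closure (¬ᶠ A)   = closure A
closure (□ A)    = □ A ∷ []
closure (◇ A)    = ◇ A ∷ []
closure (A ∧ᶠ B) = closure A ++ closure B
closure (A ∨ᶠ B) = closure A ++ closure B
closure (A ⇒ B)  = (A ⇒ B) ∷ closure A ++ closure B ++ demodClosure (A ⇒ B)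

++⊆ : ∀ {xs ys zs : List Fml} → xs ⊆ zs → ys ⊆ zs → xs ++ ys ⊆ zs
++⊆ {xs} xs⊆ ys⊆ x∈ with ∈-++⁻ xs x∈
... | inj₁ x∈xs = xs⊆ x∈xs
... | inj₂ x∈ys = ys⊆ x∈ys

⊆-shift : ∀ {S : List Fml} x xs ys → S ⊆ (x ∷ xs) ++ ys → S ⊆ xs ++ x ∷ ys
⊆-shift x xs ys S⊆ = ⊆-trans S⊆ (⊆-reflexive-↭ (↭-sym (shift x xs ys)))

record Saturated (S : List Fml) (X Y : Fml) : Set where
  field
    atomsˡ : atoms X ⊆ S
    atomsʳ : atoms Y ⊆ S
    demod  : (d X ⇒ d Y) ∈ S

Closed : List Fml → Set
Closed S = ∀ {X Y} → (X ⇒ Y) ∈ S → Saturated S X Y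

Saturated-mono : ∀ {S S′ X Y} → S ⊆ S′ → Saturated S X Y → Saturated S′ X Y
Saturated-mono S⊆ sat = record
  { atomsˡ = ⊆-trans atomsˡ S⊆ ; atomsʳ = ⊆-trans atomsʳ S⊆ ; demod = S⊆ demod }
  where open Saturated sat

Closed-++ : ∀ {S T} → Closed S → Closed T → Closed (S ++ T)
Closed-++ {S} {T} S-closed T-closed m with ∈-++⁻ S m
... | inj₁ m∈S = Saturated-mono (xs⊆xs++ys S T) (S-closed m∈S)
... | inj₂ m∈T = Saturated-mono (xs⊆ys++xs T S) (T-closed m∈T)

Closed-∷ : ∀ {X Y S} → Saturated ((X ⇒ Y) ∷ S) X Y → Closed S → Closed ((X ⇒ Y) ∷ S)
Closed-∷ sat S-closed (here refl) = sat
Closed-∷ sat S-closed (there m)   = Saturated-mono there (S-closed m)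

atoms-d⊆demodClosure : ∀ A → atoms (d A) ⊆ demodClosure A
atoms-d⊆demodClosure (var p)  = λ m → m
atoms-d⊆demodClosure (¬ᶠ A)   = atoms-d⊆demodClosure A
atoms-d⊆demodClosure (□ A)    = atoms-d⊆demodClosure A
atoms-d⊆demodClosure (◇ A)    = atoms-d⊆demodClosure A
atoms-d⊆demodClosure (A ∧ᶠ B) = ++⁺ (atoms-d⊆demodClosure A) (atoms-d⊆demodClosure B)
atoms-d⊆demodClosure (A ∨ᶠ B) = ++⁺ (atoms-d⊆demodClosure A) (atoms-d⊆demodClosure B)
atoms-d⊆demodClosure (A ⇒ B)  = λ { (here refl) → here refl }

atoms⊆closure : ∀ A → atoms A ⊆ closure A
atoms⊆closure (var p)  = λ m → m
atoms⊆closure (¬ᶠ A)   = atoms⊆closure A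
atoms⊆closure (□ A)    = λ m → m
atoms⊆closure (◇ A)    = λ m → m
atoms⊆closure (A ∧ᶠ B) = ++⁺ (atoms⊆closure A) (atoms⊆closure B)
atoms⊆closure (A ∨ᶠ B) = ++⁺ (atoms⊆closure A) (atoms⊆closure B)
atoms⊆closure (A ⇒ B)  = λ { (here refl) → here refl }

demodClosure-closed : ∀ A → Closed (demodClosure A)
demodClosure-closed (var p)  = λ { (here ()) ; (there ()) }
demodClosure-closed (¬ᶠ A)   = demodClosure-closed A
demodClosure-closed (□ A)    = demodClosure-closed A
demodClosure-closed (◇ A)    = demodClosure-closed A
demodClosure-closed (A ∧ᶠ B) = Closed-++ (demodClosure-closed A) (demodClosure-closed B)
demodClosure-closed (A ∨ᶠ B) = Closed-++ (demodClosure-closed A) (demodClosure-closed B)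
demodClosure-closed (A ⇒ B)  = Closed-∷ sat (Closed-++ (demodClosure-closed A) (demodClosure-closed B))
  where
    sat : Saturated (demodClosure (A ⇒ B)) (d A) (d B)
    sat = record
      { atomsˡ = there ∘ ∈-++⁺ˡ ∘ atoms-d⊆demodClosure A
      ; atomsʳ = there ∘ ∈-++⁺ʳ (demodClosure A) ∘ atoms-d⊆demodClosure B
      ; demod  = here (cong₂ _⇒_ (d-idempotent A) (d-idempotent B))
      }

closure-closed : ∀ A → Closed (closure A)
closure-closed (var p)  = λ { (here ()) ; (there ()) }
closure-closed (¬ᶠ A)   = closure-closed A
closure-closed (□ A)    = λ { (here ()) ; (there ()) }
closure-closed (◇ A)    = λ { (here ()) ; (there ()) }
closure-closed (A ∧ᶠ B) = Closed-++ (closure-closed A) (closure-closed B)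
closure-closed (A ∨ᶠ B) = Closed-++ (closure-closed A) (closure-closed B)
closure-closed (A ⇒ B)  =
  Closed-∷ sat (Closed-++ (closure-closed A) (Closed-++ (closure-closed B) (demodClosure-closed (A ⇒ B))))
  where
    sat : Saturated (closure (A ⇒ B)) A B
    sat = record
      { atomsˡ = there ∘ ∈-++⁺ˡ ∘ atoms⊆closure A
      ; atomsʳ = there ∘ ∈-++⁺ʳ (closure A) ∘ ∈-++⁺ˡ ∘ atoms⊆closure B
      ; demod  = there (∈-++⁺ʳ (closure A) (∈-++⁺ʳ (closure B) (here refl)))
      }

contradictory-atoms : ∀ {Y Z} → Contradictory Y Z → atoms Z ⊆ atoms Y
contradictory-atoms (negation _)   m = m
contradictory-atoms (unnegation _) m = m

depth : Fml → ℕ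
depth (var p)  = 0
depth (¬ᶠ A)   = depth A
depth (□ A)    = suc (depth A)
depth (◇ A)    = suc (depth A)
depth (A ∧ᶠ B) = depth A ⊔ depth B
depth (A ∨ᶠ B) = depth A ⊔ depth B
depth (A ⇒ B)  = depth A ⊔ depth B

data Modal : Fml → Fml → Set where
  □-modal : ∀ A → Modal (□ A) A
  ◇-modal : ∀ A → Modal (◇ A) A

demodClosure-nonmodal : ∀ A {M X} → Modal M X → ¬ M ∈ demodClosure A
demodClosure-nonmodal (var p)  (□-modal _) (here ())
demodClosure-nonmodal (var p)  (◇-modal _) (here ())
demodClosure-nonmodal (¬ᶠ A)   μ m = demodClosure-nonmodal A μ m
demodClosure-nonmodal (□ A)    μ m = demodClosure-nonmodal A μ m
demodClosure-nonmodal (◇ A)    μ m = demodClosure-nonmodal A μ m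
demodClosure-nonmodal (A ∧ᶠ B) μ m with ∈-++⁻ (demodClosure A) m
... | inj₁ m∈A = demodClosure-nonmodal A μ m∈A
... | inj₂ m∈B = demodClosure-nonmodal B μ m∈B
demodClosure-nonmodal (A ∨ᶠ B) μ m with ∈-++⁻ (demodClosure A) m
... | inj₁ m∈A = demodClosure-nonmodal A μ m∈A
... | inj₂ m∈B = demodClosure-nonmodal B μ m∈B
demodClosure-nonmodal (A ⇒ B)  (□-modal _) (here ())
demodClosure-nonmodal (A ⇒ B)  (◇-modal _) (here ())
demodClosure-nonmodal (A ⇒ B)  μ (there m) with ∈-++⁻ (demodClosure A) m
... | inj₁ m∈A = demodClosure-nonmodal A μ m∈A
... | inj₂ m∈B = demodClosure-nonmodal B μ m∈B

ModalBelow : ℕ → List Fml → Set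
ModalBelow n S = ∀ {M X} → Modal M X → M ∈ S → depth X < n

ModalBelow-++ : ∀ {n S T} → ModalBelow n S → ModalBelow n T → ModalBelow n (S ++ T)
ModalBelow-++ {S = S} S-below T-below μ m with ∈-++⁻ S m
... | inj₁ m∈S = S-below μ m∈S
... | inj₂ m∈T = T-below μ m∈T

ModalBelow-⊔ : ∀ A B {S T} → ModalBelow (depth A) S → ModalBelow (depth B) T →
               ModalBelow (depth A ⊔ depth B) (S ++ T)
ModalBelow-⊔ A B S-below T-below = ModalBelow-++ (λ μ m → m<n⇒m<n⊔o (depth B) (S-below μ m))
                                                 (λ μ m → m<n⇒m<o⊔n (depth A) (T-below μ m))

closure-depth : ∀ A → ModalBelow (depth A) (closure A)
closure-depth (var p)  (□-modal _) (here ())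
closure-depth (var p)  (◇-modal _) (here ())
closure-depth (¬ᶠ A)   = closure-depth A
closure-depth (□ A)    (□-modal _) (here refl) = ≤-refl
closure-depth (◇ A)    (◇-modal _) (here refl) = ≤-refl
closure-depth (A ∧ᶠ B) = ModalBelow-⊔ A B (closure-depth A) (closure-depth B)
closure-depth (A ∨ᶠ B) = ModalBelow-⊔ A B (closure-depth A) (closure-depth B)
closure-depth (A ⇒ B)  (□-modal _) (here ())
closure-depth (A ⇒ B)  (◇-modal _) (here ())
closure-depth (A ⇒ B)  μ (there m) =
  ModalBelow-⊔ A B (closure-depth A)
    (ModalBelow-++ (closure-depth B) λ μ m → ⊥-elim (demodClosure-nonmodal (A ⇒ B) μ m)) μ m

⋀-depth : ∀ As {n} → 0 < n → (∀ {A} → A ∈ As → depth A < n) → depth (⋀ As) < n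
⋀-depth []       0<n _ = 0<n
⋀-depth (A ∷ As) 0<n h = ⊔-pres-<m (h (here refl)) (⋀-depth As 0<n (h ∘ there))


true≢false : true ≢ false
true≢false ()

⊃ᵇ-intro : ∀ {a b} → (a ≡ true → b ≡ true) → (not a ∨ b) ≡ true
⊃ᵇ-intro {false} _ = refl
⊃ᵇ-intro {true}  h = h refl

⊃ᵇ-elim : ∀ {a b} → (not a ∨ b) ≡ true → a ≡ true → b ≡ true
⊃ᵇ-elim h refl = h

∨ᵇ-intro : ∀ {a b} → a ≡ true ⊎ b ≡ true → (a ∨ b) ≡ true
∨ᵇ-intro {true}  _        = refl
∨ᵇ-intro {false} (inj₂ h) = h

∧ᵇ-intro : ∀ {a b} → a ≡ true → b ≡ true → (a ∧ b) ≡ true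
∧ᵇ-intro refl h = h

⊃ᵇ-false : ∀ {a b} → a ≡ true → b ≡ false → (not a ∨ b) ≡ false
⊃ᵇ-false refl b = b

∨ᵇ-false : ∀ {a b} → a ≡ false → b ≡ false → (a ∨ b) ≡ false
∨ᵇ-false refl b = b

∧¬ᵇ-false : ∀ {a b} → ¬ (a ≡ true × b ≡ false) → (a ∧ not b) ≡ false
∧¬ᵇ-false {false}        _ = refl
∧¬ᵇ-false {true} {true}  _ = refl
∧¬ᵇ-false {true} {false} h = ⊥-elim (h (refl , refl))

guarded-false : ∀ {a x y} → (a ≡ true → x ≡ true × y ≡ false) → (a ∧ (not x ∨ y)) ≡ false
guarded-false {false} _ = refl
guarded-false {true}  h with refl , refl ← h refl = refl

guarded-true : ∀ {a} x y → a ≡ true → (a ∧ (not x ∨ y)) ≡ true ⊎ (x ≡ true × y ≡ false)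
guarded-true false _     refl = inj₁ refl
guarded-true true  true  refl = inj₁ refl
guarded-true true  false refl = inj₂ (refl , refl)


-- Finite tree models and soundness

-- A node interprets → by an arbitrary function of the two argument formulas and their truth values
-- there; its children are the successors for □ and ◇.
data Tree : Set where
  node : (ℕ → Bool) → (Fml → Fml → Bool → Bool → Bool) → List Tree → Tree

mutual
  ⟦_⟧ : Fml → Tree → Bool
  ⟦ var p ⟧  (node v f cs) = v p
  ⟦ ¬ᶠ A ⟧   t             = not (⟦ A ⟧ t)
  ⟦ □ A ⟧    (node v f cs) = everywhere A cs
  ⟦ ◇ A ⟧    (node v f cs) = not (everywhere (¬ᶠ A) cs)
  ⟦ A ∧ᶠ B ⟧ t             = ⟦ A ⟧ t ∧ ⟦ B ⟧ t
  ⟦ A ∨ᶠ B ⟧ t             = ⟦ A ⟧ t ∨ ⟦ B ⟧ t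
  ⟦ A ⇒ B ⟧  (node v f cs) = f A B (⟦ A ⟧ (node v f cs)) (⟦ B ⟧ (node v f cs))

  everywhere : Fml → List Tree → Bool
  everywhere A []       = true
  everywhere A (c ∷ cs) = ⟦ A ⟧ c ∧ everywhere A cs

record Admissible (t : Tree) : Set where
  field
    aristotle-fails : ∀ {X Y} → Contradictory X Y → ⟦ X ⇒ Y ⟧ t ≡ false
    boethius-holds  : ∀ {X Y} → Boethius X Y → ⟦ X ⇒ Y ⟧ t ≡ true
    modus-ponens    : ∀ {X Y} → ⟦ X ⇒ Y ⟧ t ≡ true → ⟦ X ⟧ t ≡ true → ⟦ Y ⟧ t ≡ true
    demodalization  : ∀ {X Y} → ⟦ d X ⇒ d Y ⟧ t ≡ true →
                      ⟦ X ⇒ Y ⟧ t ≡ true ⊎ (⟦ X ⟧ t ≡ true × ⟦ Y ⟧ t ≡ false)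

data Model : Tree → Set where
  model : ∀ {v f cs} → Admissible (node v f cs) → All Model cs → Model (node v f cs)

⟦inst⟧ : ∀ t σ T → ⟦ inst σ T ⟧ t ≡ eval (λ n → ⟦ σ n ⟧ t) T
⟦inst⟧ t σ (cvar p)   = refl
⟦inst⟧ t σ (cneg T)   = cong not (⟦inst⟧ t σ T)
⟦inst⟧ t σ (cand T U) = cong₂ _∧_ (⟦inst⟧ t σ T) (⟦inst⟧ t σ U)
⟦inst⟧ t σ (cor T U)  = cong₂ _∨_ (⟦inst⟧ t σ T) (⟦inst⟧ t σ U)

everywhere-All : ∀ {A cs} → All (λ c → ⟦ A ⟧ c ≡ true) cs → everywhere A cs ≡ true
everywhere-All []       = refl
everywhere-All (h ∷ hs) = ∧ᵇ-intro h (everywhere-All hs)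

everywhere-mp : ∀ {A B} cs → everywhere (A ⊃ B) cs ≡ true → everywhere A cs ≡ true → everywhere B cs ≡ true
everywhere-mp []       _ _ = refl
everywhere-mp {A} (c ∷ cs) h a =
  ∧ᵇ-intro (⊃ᵇ-elim (∧-conicalˡ _ _ h) (∧-conicalˡ (⟦ A ⟧ c) _ a))
           (everywhere-mp cs (∧-conicalʳ _ _ h) (∧-conicalʳ _ _ a))

everywhere-Any : ∀ {A cs} → Any (λ c → ⟦ A ⟧ c ≡ false) cs → everywhere A cs ≡ false
everywhere-Any (here A-false) = cong (_∧ _) A-false
everywhere-Any {A} {c ∷ _} (there any) = trans (cong (⟦ A ⟧ c ∧_) (everywhere-Any any)) (∧-zeroʳ _)

soundness : ∀ {A t} → ⊢ A → Model t → ⟦ A ⟧ t ≡ true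
soundness {t = t} (taut T σ T-taut) _ = trans (⟦inst⟧ t σ T) (T-taut _)
soundness (ax1 A)   (model adm _) = cong not (Admissible.aristotle-fails adm (negation A))
soundness (ax2 A)   (model adm _) = cong not (Admissible.aristotle-fails adm (unnegation A))
soundness (ax3 A B) (model adm _) = Admissible.boethius-holds adm (boethius A (negation B))
soundness (ax4 A B) (model adm _) = Admissible.boethius-holds adm (boethius A (unnegation B))
soundness (ax5 A B) (model adm _) = ⊃ᵇ-intro λ h → ⊃ᵇ-intro (Admissible.modus-ponens adm h)
soundness {t = t} (axDia A) (model _ _) = cong₂ _∧_ (∨-inverseˡ (⟦ ◇ A ⟧ t)) (∨-inverseˡ (⟦ ◇ A ⟧ t))
soundness (axK A B) (model {cs = cs} _ _) = ⊃ᵇ-intro λ h → ⊃ᵇ-intro (everywhere-mp cs h)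
soundness (axD A B) (model adm _) = ⊃ᵇ-intro λ h → ∨ᵇ-intro (case (Admissible.demodalization adm h))
  where
    case : ∀ {a x y} → a ≡ true ⊎ (x ≡ true × y ≡ false) → a ≡ true ⊎ (x ∧ not y) ≡ true
    case (inj₁ a)           = inj₁ a
    case (inj₂ (x , refl)) = inj₂ (∧ᵇ-intro x refl)
soundness (mp ⊢A ⊢A⊃B) m = ⊃ᵇ-elim (soundness ⊢A⊃B m) (soundness ⊢A m)
soundness (nec ⊢A) (model _ ms) = everywhere-All (All.map (soundness ⊢A) ms)

record Countermodel (A : Fml) : Set where
  field
    tree    : Tree
    isModel : Model tree
    refutes : ⟦ A ⟧ tree ≡ false

countermodel-unprovable : ∀ {A} → Countermodel A → ¬ ⊢ A
countermodel-unprovable record { isModel = M ; refutes = A-false } ⊢A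
  with () ← trans (sym (soundness ⊢A M)) A-false

⋀-true : ∀ {t A As} → ⟦ ⋀ As ⟧ t ≡ true → A ∈ As → ⟦ A ⟧ t ≡ true
⋀-true h (here refl) = ∧-conicalˡ _ _ h
⋀-true h (there A∈)  = ⋀-true (∧-conicalʳ _ _ h) A∈


-- Kalmar's lemma

Assignment : Set
Assignment = List (Fml × Bool)

keys : Assignment → List Fml
keys = List.map proj₁

atomValue : Assignment → Fml → Bool
atomValue []            a = false
atomValue ((x , b) ∷ L) a with a ≟ x
... | yes _ = b
... | no _  = atomValue L a

value : Assignment → Fml → Bool
value L (¬ᶠ A)   = not (value L A)
value L (A ∧ᶠ B) = value L A ∧ value L B
value L (A ∨ᶠ B) = value L A ∨ value L B
value L A        = atomValue L A

literal : Bool → Fml → Fml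
literal true  A = A
literal false A = ¬ᶠ A

conj : Assignment → Fml
conj []            = ⊤ᶠ
conj ((a , b) ∷ L) = literal b a ∧ᶠ conj L

kalmar-atom : ∀ L {a} → a ∈ keys L → ⊢ (conj L ⊃ literal (atomValue L a) a)
kalmar-atom ((x , b) ∷ L) {a} a∈ with a ≟ x | a∈
... | yes refl | _ = tautology (p₀ ∧ᶜ p₁ ⊃ᶜ p₀) (literal b a ∷ conj L ∷ [])
... | no a≢x | here a≡x = ⊥-elim (a≢x a≡x)
... | no _   | there a∈L =
  mp (kalmar-atom L a∈L)
     (tautology ((p₁ ⊃ᶜ p₂) ⊃ᶜ p₀ ∧ᶜ p₁ ⊃ᶜ p₂) (literal b x ∷ conj L ∷ literal (atomValue L a) a ∷ []))

module _ {C : Fml} where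

  kalmar-¬ : ∀ {A} b → ⊢ (C ⊃ literal b A) → ⊢ (C ⊃ literal (not b) (¬ᶠ A))
  kalmar-¬ {A} true  ⊢A = mp ⊢A (tautology ((p₀ ⊃ᶜ p₁) ⊃ᶜ p₀ ⊃ᶜ ¬ᶜ ¬ᶜ p₁) (C ∷ A ∷ []))
  kalmar-¬     false ⊢¬A = ⊢¬A

  kalmar-∧ : ∀ {A B} b c → ⊢ (C ⊃ literal b A) → ⊢ (C ⊃ literal c B) → ⊢ (C ⊃ literal (b ∧ c) (A ∧ᶠ B))
  kalmar-∧ {A} {B} true true ⊢A ⊢B =
    mp ⊢B (mp ⊢A (tautology ((p₀ ⊃ᶜ p₁) ⊃ᶜ (p₀ ⊃ᶜ p₂) ⊃ᶜ p₀ ⊃ᶜ p₁ ∧ᶜ p₂) (C ∷ A ∷ B ∷ [])))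
  kalmar-∧ {A} {B} true false _ ⊢¬B =
    mp ⊢¬B (tautology ((p₀ ⊃ᶜ ¬ᶜ p₂) ⊃ᶜ p₀ ⊃ᶜ ¬ᶜ (p₁ ∧ᶜ p₂)) (C ∷ A ∷ B ∷ []))
  kalmar-∧ {A} {B} false _ ⊢¬A _ =
    mp ⊢¬A (tautology ((p₀ ⊃ᶜ ¬ᶜ p₁) ⊃ᶜ p₀ ⊃ᶜ ¬ᶜ (p₁ ∧ᶜ p₂)) (C ∷ A ∷ B ∷ []))

  kalmar-∨ : ∀ {A B} b c → ⊢ (C ⊃ literal b A) → ⊢ (C ⊃ literal c B) → ⊢ (C ⊃ literal (b ∨ c) (A ∨ᶠ B))
  kalmar-∨ {A} {B} true _ ⊢A _ =
    mp ⊢A (tautology ((p₀ ⊃ᶜ p₁) ⊃ᶜ p₀ ⊃ᶜ p₁ ∨ᶜ p₂) (C ∷ A ∷ B ∷ []))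
  kalmar-∨ {A} {B} false true _ ⊢B =
    mp ⊢B (tautology ((p₀ ⊃ᶜ p₂) ⊃ᶜ p₀ ⊃ᶜ p₁ ∨ᶜ p₂) (C ∷ A ∷ B ∷ []))
  kalmar-∨ {A} {B} false false ⊢¬A ⊢¬B =
    mp ⊢¬B (mp ⊢¬A (tautology ((p₀ ⊃ᶜ ¬ᶜ p₁) ⊃ᶜ (p₀ ⊃ᶜ ¬ᶜ p₂) ⊃ᶜ p₀ ⊃ᶜ ¬ᶜ (p₁ ∨ᶜ p₂)) (C ∷ A ∷ B ∷ [])))

kalmar : ∀ L A → atoms A ⊆ keys L → ⊢ (conj L ⊃ literal (value L A) A)
kalmar L (var p)  cov = kalmar-atom L (cov (here refl))
kalmar L (¬ᶠ A)   cov = kalmar-¬ (value L A) (kalmar L A cov)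
kalmar L (□ A)    cov = kalmar-atom L (cov (here refl))
kalmar L (◇ A)    cov = kalmar-atom L (cov (here refl))
kalmar L (A ∧ᶠ B) cov =
  kalmar-∧ (value L A) (value L B) (kalmar L A (cov ∘ ∈-++⁺ˡ)) (kalmar L B (cov ∘ ∈-++⁺ʳ (atoms A)))
kalmar L (A ∨ᶠ B) cov =
  kalmar-∨ (value L A) (value L B) (kalmar L A (cov ∘ ∈-++⁺ˡ)) (kalmar L B (cov ∘ ∈-++⁺ʳ (atoms A)))
kalmar L (A ⇒ B)  cov = kalmar-atom L (cov (here refl))

kalmar-false : ∀ L {A} → atoms A ⊆ keys L → value L A ≡ false → ⊢ (conj L ⊃ (¬ᶠ A))
kalmar-false L {A} cov A-false = subst (λ b → ⊢ (conj L ⊃ literal b A)) A-false (kalmar L A cov)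

kalmar-true : ∀ L {A} → atoms A ⊆ keys L → value L A ≡ true → ⊢ (conj L ⊃ A)
kalmar-true L {A} cov A-true = subst (λ b → ⊢ (conj L ⊃ literal b A)) A-true (kalmar L A cov)

record Refutation (L : Assignment) : Set where
  constructor refutation
  field
    formula   : Fml
    provable  : ⊢ formula
    covered   : atoms formula ⊆ keys L
    falsified : value L formula ≡ false

refutation-⊢ : ∀ {L} A → Refutation L → ⊢ (conj L ⊃ A)
refutation-⊢ {L} A (refutation Φ ⊢Φ cov Φ-false) =
  mp (kalmar-false L cov Φ-false) (mp ⊢Φ (tautology (p₁ ⊃ᶜ (p₀ ⊃ᶜ ¬ᶜ p₁) ⊃ᶜ p₀ ⊃ᶜ p₂) (conj L ∷ Φ ∷ A ∷ [])))


by-cases : ∀ {Q P : Set} → Dec Q → (Q → P) → (¬ Q → P) → P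
by-cases (yes q) yes-case _       = yes-case q
by-cases (no ¬q) _        no-case = no-case ¬q

assuming : ∀ {Q P R : Set} → Dec Q → (Q → P ⊎ R) → (Q → P) ⊎ R
assuming (yes q) k = Sum.map₁ (λ p _ → p) (k q)
assuming (no ¬q) _ = inj₁ (⊥-elim ∘ ¬q)

establishing : ∀ {P R : Set} → Dec P → (¬ P → R) → P ⊎ R
establishing (yes p) _ = inj₁ p
establishing (no ¬p) k = inj₂ (k ¬p)

infixr 2 _⊗_

_⊗_ : ∀ {P Q R : Set} → P ⊎ R → Q ⊎ R → (P × Q) ⊎ R
inj₁ p ⊗ inj₁ q = inj₁ (p , q)
inj₁ _ ⊗ inj₂ r = inj₂ r
inj₂ r ⊗ _      = inj₂ r

all-or-some : ∀ {A R : Set} {P : A → Set} (xs : List A) → (∀ {x} → x ∈ xs → P x ⊎ R) → All P xs ⊎ R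
all-or-some []       _ = inj₁ []
all-or-some (x ∷ xs) h with h (here refl) | all-or-some xs (h ∘ there)
... | inj₂ r | _       = inj₂ r
... | inj₁ _ | inj₂ r  = inj₂ r
... | inj₁ p | inj₁ ps = inj₁ (p ∷ ps)

for-contradictories : ∀ {Y R} {P : Fml → Set} → (∀ {Z} → Contradictory Y Z → P Z ⊎ R) →
                      (∀ {Z} → Contradictory Y Z → P Z) ⊎ R
for-contradictories {Y} {P = P} check =
  Sum.map₁ (λ all c → All.lookup all (contradictory-∈ c) c)
    (all-or-some {P = λ Z → Contradictory Y Z → P Z} (contradictories Y)
       λ {Z} _ → assuming (Contradictory? Y Z) check)


-- The node built from an assignment of the closure

module Leaf (A₀ : Fml) (L : Assignment) (covers : closure A₀ ⊆ keys L) where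

  cl : List Fml
  cl = closure A₀

  val : Fml → Bool
  val = value L

  -- On demodalized arguments, the value of → at the node built below (see demod-arrow).
  baseValue : Fml → Fml → Bool
  baseValue X Y = if does ((X ⇒ Y) ∈? cl) then val (X ⇒ Y) else does (Boethius? X Y)

  baseValue-∈ : ∀ {X Y} → (X ⇒ Y) ∈ cl → baseValue X Y ≡ val (X ⇒ Y)
  baseValue-∈ m = cong (if_then _ else _) (dec-true (_ ∈? cl) m)

  baseValue-∉ : ∀ {X Y} → ¬ (X ⇒ Y) ∈ cl → baseValue X Y ≡ does (Boethius? X Y)
  baseValue-∉ m∉ = cong (if_then _ else _) (dec-false (_ ∈? cl) m∉)

  baseValue-true : ∀ {X Y} → baseValue X Y ≡ true → ((X ⇒ Y) ∈ cl × val (X ⇒ Y) ≡ true) ⊎ Boethius X Y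
  baseValue-true {X} {Y} h with (X ⇒ Y) ∈? cl | Boethius? X Y
  ... | yes m | _     = inj₁ (m , h)
  ... | no _  | yes b = inj₂ b

  -- The last two fields make X ⇒ Y exclude X ⇒ Z
  -- at the node built below even when X ⇒ Z lies outside the closure; modus ponens for Boethius'
  -- theses depends on this.
  record ArrowChecks (X Y : Fml) : Set where
    field
      aristotle-fails : Contradictory X Y → val (X ⇒ Y) ≡ false
      boethius-holds  : Boethius X Y → val (X ⇒ Y) ≡ true
      modus-ponens    : val (X ⇒ Y) ≡ true → val X ≡ true → val Y ≡ true
      demodalization  : val (d X ⇒ d Y) ≡ true → val (X ⇒ Y) ≡ true ⊎ (val X ≡ true × val Y ≡ false)
      exclusion       : ∀ {Z} → Contradictory Y Z → val (X ⇒ Y) ≡ true → baseValue X Z ≡ false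
      exclusion-d     : ∀ {Z} → Contradictory Y Z → val (X ⇒ Y) ≡ true → baseValue (d X) (d Z) ≡ true →
                        val X ≡ true × val Z ≡ false

  module _ {X Y : Fml} (m : (X ⇒ Y) ∈ cl) where
    private
      open Saturated (closure-closed A₀ m)
      coverˡ : atoms X ⊆ keys L
      coverˡ = covers ∘ atomsˡ
      coverʳ : atoms Y ⊆ keys L
      coverʳ = covers ∘ atomsʳ
      cover⇒ : atoms (X ⇒ Y) ⊆ keys L
      cover⇒ = ∈-∷⁺ʳ (covers m) λ ()

    check-aristotle : (Contradictory X Y → val (X ⇒ Y) ≡ false) ⊎ Refutation L
    check-aristotle = assuming (Contradictory? X Y) λ c →
      establishing (val (X ⇒ Y) Bool.≟ false) λ ne →
        refutation _ (aristotle-⊢ c) cover⇒ (cong not (¬-not ne))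

    check-boethius : (Boethius X Y → val (X ⇒ Y) ≡ true) ⊎ Refutation L
    check-boethius = assuming (Boethius? X Y) λ b →
      establishing (val (X ⇒ Y) Bool.≟ true) λ ne →
        refutation _ (boethius-⊢ b) cover⇒ (¬-not ne)

    check-modus-ponens : (val (X ⇒ Y) ≡ true → val X ≡ true → val Y ≡ true) ⊎ Refutation L
    check-modus-ponens = assuming (val (X ⇒ Y) Bool.≟ true) λ xy → assuming (val X Bool.≟ true) λ x →
      establishing (val Y Bool.≟ true) λ ne →
        refutation _ (ax5 X Y) (∈-∷⁺ʳ (covers m) (++⊆ coverˡ coverʳ)) (⊃ᵇ-false xy (⊃ᵇ-false x (¬-not ne)))

    check-demodalization :
      (val (d X ⇒ d Y) ≡ true → val (X ⇒ Y) ≡ true ⊎ (val X ≡ true × val Y ≡ false)) ⊎ Refutation L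
    check-demodalization = assuming (val (d X ⇒ d Y) Bool.≟ true) λ dxy →
      establishing (val (X ⇒ Y) Bool.≟ true ⊎-dec (val X Bool.≟ true ×-dec val Y Bool.≟ false)) λ ne →
        refutation _ (axD X Y) (∈-∷⁺ʳ (covers demod) (∈-∷⁺ʳ (covers m) (++⊆ coverˡ coverʳ)))
                   (⊃ᵇ-false dxy (∨ᵇ-false (¬-not (ne ∘ inj₁)) (∧¬ᵇ-false (ne ∘ inj₂))))

    check-exclusion : ∀ {Z} → Contradictory Y Z → (val (X ⇒ Y) ≡ true → baseValue X Z ≡ false) ⊎ Refutation L
    check-exclusion {Z} c = assuming (val (X ⇒ Y) Bool.≟ true) λ xy →
      establishing (baseValue X Z Bool.≟ false) λ ne → refute xy (baseValue-true (¬-not ne))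
      where
        refute : val (X ⇒ Y) ≡ true → ((X ⇒ Z) ∈ cl × val (X ⇒ Z) ≡ true) ⊎ Boethius X Z → Refutation L
        refute xy (inj₁ (mz , xz)) =
          refutation _ (exclusion-⊢ X c) (∈-∷⁺ʳ (covers m) (∈-∷⁺ʳ (covers mz) λ ())) (⊃ᵇ-false xy (cong not xz))
        refute xy (inj₂ b) =
          refutation _ (mp (boethius-⊢ b) (mp (exclusion-⊢ X c)
                         (tautology ((p₀ ⊃ᶜ ¬ᶜ p₁) ⊃ᶜ p₁ ⊃ᶜ ¬ᶜ p₀) ((X ⇒ Y) ∷ (X ⇒ Z) ∷ []))))
                     cover⇒ (cong not xy)

    check-exclusion-d : ∀ {Z} → Contradictory Y Z →
      (val (X ⇒ Y) ≡ true → baseValue (d X) (d Z) ≡ true → val X ≡ true × val Z ≡ false) ⊎ Refutation L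
    check-exclusion-d {Z} c = assuming (val (X ⇒ Y) Bool.≟ true) λ xy →
      assuming (baseValue (d X) (d Z) Bool.≟ true) λ base →
      establishing (val X Bool.≟ true ×-dec val Z Bool.≟ false) λ ¬xz → refute xy ¬xz (baseValue-true base)
      where
        coverᶻ : atoms X ++ atoms (¬ᶠ Z) ⊆ keys L
        coverᶻ = ++⊆ coverˡ (coverʳ ∘ contradictory-atoms c)
        refute : val (X ⇒ Y) ≡ true → ¬ (val X ≡ true × val Z ≡ false) →
                 ((d X ⇒ d Z) ∈ cl × val (d X ⇒ d Z) ≡ true) ⊎ Boethius (d X) (d Z) → Refutation L
        refute xy ¬xz (inj₁ (mz , dxz)) =
          refutation _ (exclusion-d-⊢ X c) (∈-∷⁺ʳ (covers m) (∈-∷⁺ʳ (covers mz) coverᶻ))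
                     (⊃ᵇ-false (∧ᵇ-intro xy dxz) (∧¬ᵇ-false ¬xz))
        refute xy ¬xz (inj₂ b) =
          refutation _ (mp (boethius-⊢ b) (mp (exclusion-d-⊢ X c)
                         (tautology ((p₀ ∧ᶜ p₁ ⊃ᶜ p₂) ⊃ᶜ p₁ ⊃ᶜ p₀ ⊃ᶜ p₂)
                                    ((X ⇒ Y) ∷ (d X ⇒ d Z) ∷ (X ∧ᶠ (¬ᶠ Z)) ∷ []))))
                     (∈-∷⁺ʳ (covers m) coverᶻ) (⊃ᵇ-false xy (∧¬ᵇ-false ¬xz))

    check-arrow : ArrowChecks X Y ⊎ Refutation L
    check-arrow
      with check-aristotle ⊗ check-boethius ⊗ check-modus-ponens ⊗ check-demodalization ⊗
           for-contradictories {P = λ Z → val (X ⇒ Y) ≡ true → baseValue X Z ≡ false} check-exclusion ⊗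
           for-contradictories {P = λ Z → val (X ⇒ Y) ≡ true → baseValue (d X) (d Z) ≡ true →
                                     val X ≡ true × val Z ≡ false}
                               check-exclusion-d
    ... | inj₂ r = inj₂ r
    ... | inj₁ (ar , bo , mo , de , ex , exᵈ) = inj₁ record
      { aristotle-fails = ar ; boethius-holds = bo ; modus-ponens = mo ; demodalization = de
      ; exclusion = ex ; exclusion-d = exᵈ }

  ArrowOK : Fml → Set
  ArrowOK (X ⇒ Y) = ArrowChecks X Y
  ArrowOK _       = ⊤

  check-arrows : (∀ {X Y} → (X ⇒ Y) ∈ cl → ArrowChecks X Y) ⊎ Refutation L
  check-arrows = Sum.map₁ (λ all m → All.lookup all m) (all-or-some cl check-atom)
    where
      check-atom : ∀ {x} → x ∈ cl → ArrowOK x ⊎ Refutation L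
      check-atom {X ⇒ Y}  m = check-arrow m
      check-atom {var _}  _ = inj₁ tt
      check-atom {¬ᶠ _}   _ = inj₁ tt
      check-atom {□ _}    _ = inj₁ tt
      check-atom {◇ _}    _ = inj₁ tt
      check-atom {_ ∧ᶠ _} _ = inj₁ tt
      check-atom {_ ∨ᶠ _} _ = inj₁ tt

  -- □ Y has truth value b at the node to be built, as dictated by a modal atom of the closure
  -- (◇ X being read as ¬ □ ¬ X).
  data BoxLiteral (Y : Fml) (b : Bool) : Set where
    from-□ : □ Y ∈ cl → val (□ Y) ≡ b → BoxLiteral Y b
    from-◇ : ∀ {X} → Y ≡ ¬ᶠ X → ◇ X ∈ cl → not (val (◇ X)) ≡ b → BoxLiteral Y b

  boxLiteral-depth : ∀ {Y b} → BoxLiteral Y b → depth Y < depth A₀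
  boxLiteral-depth (from-□ m _)      = closure-depth A₀ (□-modal _) m
  boxLiteral-depth (from-◇ refl m _) = closure-depth A₀ (◇-modal _) m

  boxLiteral-⊢ : ∀ {Y b} → BoxLiteral Y b → ⊢ (conj L ⊃ literal b (□ Y))
  boxLiteral-⊢ (from-□ m refl)      = kalmar-atom L (covers m)
  boxLiteral-⊢ (from-◇ refl m refl) = ⊃-trans (kalmar-atom L (covers m)) (◇-literal (val (◇ _)))
    where
      ◇-literal : ∀ {X} b → ⊢ (literal b (◇ X) ⊃ literal (not b) (□ (¬ᶠ X)))
      ◇-literal {X} true  = mp (axDia X) (tautology ((p₀ ≣ᶜ ¬ᶜ p₁) ⊃ᶜ p₀ ⊃ᶜ ¬ᶜ p₁) (◇ X ∷ □ (¬ᶠ X) ∷ []))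
      ◇-literal {X} false = mp (axDia X) (tautology ((p₀ ≣ᶜ ¬ᶜ p₁) ⊃ᶜ ¬ᶜ p₀ ⊃ᶜ p₁) (◇ X ∷ □ (¬ᶠ X) ∷ []))

  boxLiteralsAt : Bool → Fml → List Fml
  boxLiteralsAt b (□ X) with val (□ X) Bool.≟ b
  ... | yes _ = X ∷ []
  ... | no _  = []
  boxLiteralsAt b (◇ X) with not (val (◇ X)) Bool.≟ b
  ... | yes _ = ¬ᶠ X ∷ []
  ... | no _  = []
  boxLiteralsAt b _ = []

  boxLiterals : Bool → List Fml
  boxLiterals b = List.concatMap (boxLiteralsAt b) cl

  boxLiterals-sound : ∀ {Y b} → Y ∈ boxLiterals b → BoxLiteral Y b
  boxLiterals-sound {Y} {b} Y∈ =
    let x , x∈cl , Y∈x = find (∈-concatMap⁻ (boxLiteralsAt b) Y∈) in sound x x∈cl Y∈x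
    where
      sound : ∀ x → x ∈ cl → Y ∈ boxLiteralsAt b x → BoxLiteral Y b
      sound (□ X) m Y∈x with val (□ X) Bool.≟ b | Y∈x
      ... | yes e | here refl = from-□ m e
      sound (◇ X) m Y∈x with not (val (◇ X)) Bool.≟ b | Y∈x
      ... | yes e | here refl = from-◇ refl m e
      sound (var _)  _ ()
      sound (¬ᶠ _)   _ ()
      sound (_ ∧ᶠ _) _ ()
      sound (_ ∨ᶠ _) _ ()
      sound (_ ⇒ _)  _ ()

  boxLiterals-complete : ∀ {Y b} → BoxLiteral Y b → Y ∈ boxLiterals b
  boxLiterals-complete {Y} {b} (from-□ m e) = ∈-concatMap⁺ (boxLiteralsAt b) (lose m Y∈)
    where
      Y∈ : Y ∈ boxLiteralsAt b (□ Y)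
      Y∈ with val (□ Y) Bool.≟ b
      ... | yes _ = here refl
      ... | no ne = ⊥-elim (ne e)
  boxLiterals-complete {_} {b} (from-◇ {X} refl m e) = ∈-concatMap⁺ (boxLiteralsAt b) (lose m ¬X∈)
    where
      ¬X∈ : ¬ᶠ X ∈ boxLiteralsAt b (◇ X)
      ¬X∈ with not (val (◇ X)) Bool.≟ b
      ... | yes _ = here refl
      ... | no ne = ⊥-elim (ne e)

  mustHold mustFail : List Fml
  mustHold = boxLiterals true
  mustFail = boxLiterals false

  challenge : Fml → Fml
  challenge π = ⋀ mustHold ⊃ π

  challenge-depth : ∀ {π} → π ∈ mustFail → depth (challenge π) < depth A₀
  challenge-depth {π} π∈ =
    ⊔-pres-<m (⋀-depth mustHold (≤-<-trans z≤n π<) (boxLiteral-depth ∘ boxLiterals-sound)) π<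
    where
      π< : depth π < depth A₀
      π< = boxLiteral-depth (boxLiterals-sound π∈)

  challenge-⊢ : ∀ {π} → π ∈ mustFail → ⊢ challenge π → ⊢ (conj L ⊃ A₀)
  challenge-⊢ {π} π∈ ⊢challenge =
    mp (boxLiteral-⊢ (boxLiterals-sound π∈))
      (mp (⊃-trans (□⋀-⊢ mustHold (boxLiteral-⊢ ∘ boxLiterals-sound)) (□-mono ⊢challenge))
        (tautology ((p₀ ⊃ᶜ p₁) ⊃ᶜ (p₀ ⊃ᶜ ¬ᶜ p₁) ⊃ᶜ p₀ ⊃ᶜ p₂) (conj L ∷ □ π ∷ A₀ ∷ [])))

  decide-challenges : (∀ B → depth B < depth A₀ → ⊢ B ⊎ Countermodel B) →
                      All (Countermodel ∘ challenge) mustFail ⊎ ⊢ (conj L ⊃ A₀)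
  decide-challenges decide = all-or-some mustFail λ π∈ →
    Sum.[ inj₂ ∘ challenge-⊢ π∈ , inj₁ ]′ (decide _ (challenge-depth π∈))

  children : ∀ {πs} → All (Countermodel ∘ challenge) πs → List Tree
  children []       = []
  children (k ∷ ks) = Countermodel.tree k ∷ children ks

  children-models : ∀ {πs} (ks : All (Countermodel ∘ challenge) πs) → All Model (children ks)
  children-models []       = []
  children-models (k ∷ ks) = Countermodel.isModel k ∷ children-models ks

  children-hold : ∀ {πs} (ks : All (Countermodel ∘ challenge) πs) →
                  All (λ t → ⟦ ⋀ mustHold ⟧ t ≡ true) (children ks)
  children-hold []       = []
  children-hold (k ∷ ks) = not-injective (∨-conicalˡ _ _ (Countermodel.refutes k)) ∷ children-hold ks

  children-fail : ∀ {πs} (ks : All (Countermodel ∘ challenge) πs) {π} → π ∈ πs →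
                  Any (λ t → ⟦ π ⟧ t ≡ false) (children ks)
  children-fail (k ∷ ks) (here refl) = here (∨-conicalʳ _ _ (Countermodel.refutes k))
  children-fail (k ∷ ks) (there π∈) = there (children-fail ks π∈)

  default : Fml → Fml → Bool → Bool → Bool
  default X Y x y =
    if does (Contradictory? X Y) then false
    else if does (Boethius? X Y) then true
    else baseValue (d X) (d Y) ∧ (not x ∨ y)

  arrow : Fml → Fml → Bool → Bool → Bool
  arrow X Y x y = if does ((X ⇒ Y) ∈? cl) then val (X ⇒ Y) else default X Y x y

  by-membership : ∀ {P : Set} x → (x ∈ cl → P) → (¬ x ∈ cl → P) → P
  by-membership x = by-cases (x ∈? cl)

  module Node (checked : ∀ {X Y} → (X ⇒ Y) ∈ cl → ArrowChecks X Y)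
              (kids : All (Countermodel ∘ challenge) mustFail) where

    t₀ : Tree
    t₀ = node (λ p → val (var p)) arrow (children kids)

    ⇒-∈ : ∀ {X Y} → (X ⇒ Y) ∈ cl → ⟦ X ⇒ Y ⟧ t₀ ≡ val (X ⇒ Y)
    ⇒-∈ {X} {Y} m with (X ⇒ Y) ∈? cl
    ... | yes _  = refl
    ... | no m∉ = ⊥-elim (m∉ m)

    ⇒-contradictory : ∀ {X Y} → ¬ (X ⇒ Y) ∈ cl → Contradictory X Y → ⟦ X ⇒ Y ⟧ t₀ ≡ false
    ⇒-contradictory {X} {Y} m∉ c with (X ⇒ Y) ∈? cl | Contradictory? X Y
    ... | yes m | _     = ⊥-elim (m∉ m)
    ... | no _  | yes _ = refl
    ... | no _  | no ¬c = ⊥-elim (¬c c)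

    ⇒-boethius : ∀ {X Y} → ¬ (X ⇒ Y) ∈ cl → Boethius X Y → ⟦ X ⇒ Y ⟧ t₀ ≡ true
    ⇒-boethius {X} {Y} m∉ b with (X ⇒ Y) ∈? cl | Contradictory? X Y | Boethius? X Y
    ... | yes m | _     | _     = ⊥-elim (m∉ m)
    ... | no _  | yes c | _     = ⊥-elim (contradictory-¬boethius c b)
    ... | no _  | no _  | yes _ = refl
    ... | no _  | no _  | no ¬b = ⊥-elim (¬b b)

    ⇒-guarded : ∀ {X Y} → ¬ (X ⇒ Y) ∈ cl → ¬ Contradictory X Y → ¬ Boethius X Y →
                ⟦ X ⇒ Y ⟧ t₀ ≡ baseValue (d X) (d Y) ∧ ⟦ X ⊃ Y ⟧ t₀
    ⇒-guarded {X} {Y} m∉ ¬c ¬b with (X ⇒ Y) ∈? cl | Contradictory? X Y | Boethius? X Y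
    ... | yes m | _     | _     = ⊥-elim (m∉ m)
    ... | no _  | yes c | _     = ⊥-elim (¬c c)
    ... | no _  | no _  | yes b = ⊥-elim (¬b b)
    ... | no _  | no _  | no _  = refl

    everywhere-boxLiteral : ∀ {Y b} → BoxLiteral Y b → everywhere Y (children kids) ≡ b
    everywhere-boxLiteral {b = true}  lit =
      everywhere-All (All.map (λ ⋀-holds → ⋀-true ⋀-holds (boxLiterals-complete lit)) (children-hold kids))
    everywhere-boxLiteral {b = false} lit = everywhere-Any (children-fail kids (boxLiterals-complete lit))

    truth : ∀ F → atoms F ⊆ cl → ⟦ F ⟧ t₀ ≡ val F
    truth (var p)  _ = refl
    truth (¬ᶠ F)   h = cong not (truth F h)
    truth (□ X)    h = everywhere-boxLiteral (from-□ (h (here refl)) refl)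
    truth (◇ X)    h =
      trans (cong not (everywhere-boxLiteral (from-◇ refl (h (here refl)) refl))) (not-involutive _)
    truth (F ∧ᶠ G) h = cong₂ _∧_ (truth F (h ∘ ∈-++⁺ˡ)) (truth G (h ∘ ∈-++⁺ʳ (atoms F)))
    truth (F ∨ᶠ G) h = cong₂ _∨_ (truth F (h ∘ ∈-++⁺ˡ)) (truth G (h ∘ ∈-++⁺ʳ (atoms F)))
    truth (F ⇒ G)  h = ⇒-∈ (h (here refl))

    baseValue-boethius : ∀ {X Y} → Boethius X Y → baseValue X Y ≡ true
    baseValue-boethius {X} {Y} b = by-membership (X ⇒ Y)
      (λ m → trans (baseValue-∈ m) (ArrowChecks.boethius-holds (checked m) b))
      (λ m∉ → trans (baseValue-∉ m∉) (dec-true (Boethius? X Y) b))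

    baseValue-contradictory : ∀ {X Y} → Contradictory X Y → baseValue X Y ≡ false
    baseValue-contradictory {X} {Y} c = by-membership (X ⇒ Y)
      (λ m → trans (baseValue-∈ m) (ArrowChecks.aristotle-fails (checked m) c))
      (λ m∉ → trans (baseValue-∉ m∉) (dec-false (Boethius? X Y) (contradictory-¬boethius c)))

    baseValue-exclusion : ∀ {X Y Z} → Contradictory Y Z → baseValue X Y ≡ true → baseValue X Z ≡ false
    baseValue-exclusion {X} {Y} {Z} c h with baseValue-true h
    ... | inj₁ (m , xy) = ArrowChecks.exclusion (checked m) c xy
    ... | inj₂ b = by-membership (X ⇒ Z)
      (λ mz → trans (baseValue-∈ mz) (¬-not λ xz →
        true≢false (trans (sym h) (ArrowChecks.exclusion (checked mz) (contradictory-sym c) xz))))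
      (λ mz∉ → trans (baseValue-∉ mz∉) (dec-false (Boethius? X Z) λ b′ → boethius-boethius-¬contradictory b b′ c))

    demod-arrow : ∀ X Y → ⟦ d X ⇒ d Y ⟧ t₀ ≡ baseValue (d X) (d Y)
    demod-arrow X Y = by-membership (d X ⇒ d Y)
      (λ m → trans (⇒-∈ m) (sym (baseValue-∈ m))) λ m∉ →
      by-cases (Contradictory? (d X) (d Y))
        (λ c → trans (⇒-contradictory m∉ c) (sym (baseValue-contradictory c))) λ ¬c →
      by-cases (Boethius? (d X) (d Y))
        (λ b → trans (⇒-boethius m∉ b) (sym (baseValue-boethius b)))
        (guarded m∉ ¬c)
      where
        guarded : ¬ (d X ⇒ d Y) ∈ cl → ¬ Contradictory (d X) (d Y) → ¬ Boethius (d X) (d Y) →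
                  ⟦ d X ⇒ d Y ⟧ t₀ ≡ baseValue (d X) (d Y)
        guarded m∉ ¬c ¬b = begin
          ⟦ d X ⇒ d Y ⟧ t₀                                 ≡⟨ ⇒-guarded m∉ ¬c ¬b ⟩
          baseValue (d (d X)) (d (d Y)) ∧ ⟦ d X ⊃ d Y ⟧ t₀ ≡⟨ cong (_∧ ⟦ d X ⊃ d Y ⟧ t₀) dd-base ⟩
          baseValue (d X) (d Y) ∧ ⟦ d X ⊃ d Y ⟧ t₀         ≡⟨ cong (_∧ ⟦ d X ⊃ d Y ⟧ t₀) base-false ⟩
          false                                            ≡⟨ base-false ⟨
          baseValue (d X) (d Y)                            ∎
          where
            dd-base : baseValue (d (d X)) (d (d Y)) ≡ baseValue (d X) (d Y)
            dd-base = cong₂ baseValue (d-idempotent X) (d-idempotent Y)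
            base-false : baseValue (d X) (d Y) ≡ false
            base-false = trans (baseValue-∉ m∉) (dec-false (Boethius? (d X) (d Y)) ¬b)

    arrow-false : ∀ {X Z} → baseValue X Z ≡ false →
                  (baseValue (d X) (d Z) ≡ true → ⟦ X ⟧ t₀ ≡ true × ⟦ Z ⟧ t₀ ≡ false) → ⟦ X ⇒ Z ⟧ t₀ ≡ false
    arrow-false {X} {Z} base guard = by-membership (X ⇒ Z)
      (λ m → trans (⇒-∈ m) (trans (sym (baseValue-∈ m)) base)) λ m∉ →
      by-cases (Contradictory? X Z) (⇒-contradictory m∉) λ ¬c →
      by-cases (Boethius? X Z) (λ b → ⊥-elim (true≢false (trans (sym (baseValue-boethius b)) base))) λ ¬b →
      trans (⇒-guarded m∉ ¬c ¬b) (guarded-false guard)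

    exclusion-∈ : ∀ {X Y Z} → Contradictory Y Z → (X ⇒ Y) ∈ cl → val (X ⇒ Y) ≡ true → ⟦ X ⇒ Z ⟧ t₀ ≡ false
    exclusion-∈ {X} {Y} {Z} c m xy = arrow-false (exclusion c xy) λ base →
      let x , z = exclusion-d c xy base
      in trans (truth X atomsˡ) x , trans (truth Z (atomsʳ ∘ contradictory-atoms c)) z
      where
        open ArrowChecks (checked m)
        open Saturated (closure-closed A₀ m)

    demod-base-true : ∀ {X Y} → ¬ (X ⇒ Y) ∈ cl → ⟦ X ⇒ Y ⟧ t₀ ≡ true → baseValue (d X) (d Y) ≡ true
    demod-base-true {X} {Y} m∉ h =
      by-cases (Contradictory? X Y) (λ c → ⊥-elim (true≢false (trans (sym h) (⇒-contradictory m∉ c)))) λ ¬c →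
      by-cases (Boethius? X Y) (baseValue-boethius ∘ boethius-d) λ ¬b →
      ∧-conicalˡ _ _ (trans (sym (⇒-guarded m∉ ¬c ¬b)) h)

    exclusion : ∀ {X Y Z} → Contradictory Y Z → ⟦ X ⇒ Y ⟧ t₀ ≡ true → ⟦ X ⇒ Z ⟧ t₀ ≡ false
    exclusion {X} {Y} {Z} c h = by-membership (X ⇒ Y)
      (λ m → exclusion-∈ c m (trans (sym (⇒-∈ m)) h)) λ m∉ →
      let baseᵈ-false = baseValue-exclusion (contradictory-d c) (demod-base-true m∉ h)
      in by-membership (X ⇒ Z)
        (λ mz → trans (⇒-∈ mz) (¬-not λ xz →
          true≢false (trans (sym h) (exclusion-∈ (contradictory-sym c) mz xz)))) λ mz∉ →
        arrow-false
          (trans (baseValue-∉ mz∉) (dec-false (Boethius? X Z) λ b →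
            true≢false (trans (sym (baseValue-boethius (boethius-d b))) baseᵈ-false)))
          (λ base → ⊥-elim (true≢false (trans (sym base) baseᵈ-false)))

    ⇒-modus-ponens : ∀ {X Y} → ⟦ X ⇒ Y ⟧ t₀ ≡ true → ⟦ X ⟧ t₀ ≡ true → ⟦ Y ⟧ t₀ ≡ true
    ⇒-modus-ponens {X} {Y} h x = by-membership (X ⇒ Y)
      (λ m → let open Saturated (closure-closed A₀ m) in
        trans (truth Y atomsʳ)
          (ArrowChecks.modus-ponens (checked m) (trans (sym (⇒-∈ m)) h) (trans (sym (truth X atomsˡ)) x))) λ m∉ →
      by-cases (Contradictory? X Y) (λ c → ⊥-elim (true≢false (trans (sym h) (⇒-contradictory m∉ c)))) λ ¬c →
      by-cases (Boethius? X Y) (λ { (boethius _ c) → cong not (exclusion c x) }) λ ¬b →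
      ⊃ᵇ-elim (∧-conicalʳ _ _ (trans (sym (⇒-guarded m∉ ¬c ¬b)) h)) x

    ⇒-demodalization : ∀ {X Y} → ⟦ d X ⇒ d Y ⟧ t₀ ≡ true →
                     ⟦ X ⇒ Y ⟧ t₀ ≡ true ⊎ (⟦ X ⟧ t₀ ≡ true × ⟦ Y ⟧ t₀ ≡ false)
    ⇒-demodalization {X} {Y} h = by-membership (X ⇒ Y)
      (λ m → let open Saturated (closure-closed A₀ m) in
        Sum.map (trans (⇒-∈ m)) (Product.map (trans (truth X atomsˡ)) (trans (truth Y atomsʳ)))
          (ArrowChecks.demodalization (checked m) (trans (sym (baseValue-∈ demod)) base))) λ m∉ →
      by-cases (Contradictory? X Y)
        (λ c → ⊥-elim (true≢false (trans (sym base) (baseValue-contradictory (contradictory-d c))))) λ ¬c →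
      by-cases (Boethius? X Y) (inj₁ ∘ ⇒-boethius m∉) λ ¬b →
      Sum.map₁ (trans (⇒-guarded m∉ ¬c ¬b)) (guarded-true _ _ base)
      where
        base : baseValue (d X) (d Y) ≡ true
        base = trans (sym (demod-arrow X Y)) h

    admissible : Admissible t₀
    admissible = record
      { aristotle-fails = λ {X} {Y} c → by-membership (X ⇒ Y)
          (λ m → trans (⇒-∈ m) (ArrowChecks.aristotle-fails (checked m) c)) (flip ⇒-contradictory c)
      ; boethius-holds  = λ {X} {Y} b → by-membership (X ⇒ Y)
          (λ m → trans (⇒-∈ m) (ArrowChecks.boethius-holds (checked m) b)) (flip ⇒-boethius b)
      ; modus-ponens    = ⇒-modus-ponens
      ; demodalization  = ⇒-demodalization
      }

    t₀-model : Model t₀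
    t₀-model = model admissible (children-models kids)

  leaf-decision : (∀ B → depth B < depth A₀ → ⊢ B ⊎ Countermodel B) → ⊢ (conj L ⊃ A₀) ⊎ Countermodel A₀
  leaf-decision decide =
    by-cases (val A₀ Bool.≟ true) (inj₁ ∘ kalmar-true L (covers ∘ atoms⊆closure A₀)) λ A₀-not-true →
    Sum.swap (Sum.map₁ (countermodel (¬-not A₀-not-true))
                       (Sum.map₂ (refutation-⊢ A₀) check-arrows ⊗ decide-challenges decide))
    where
      countermodel : val A₀ ≡ false →
                     (∀ {X Y} → (X ⇒ Y) ∈ cl → ArrowChecks X Y) × All (Countermodel ∘ challenge) mustFail →
                     Countermodel A₀
      countermodel A₀-false (checked , kids) = record
        { tree    = t₀
        ; isModel = t₀-model
        ; refutes = trans (truth A₀ (atoms⊆closure A₀)) A₀-false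
        }
        where open Node checked kids


-- The decision procedure

enumerate : ∀ A₀ → (∀ B → depth B < depth A₀ → ⊢ B ⊎ Countermodel B) →
            ∀ L rest → closure A₀ ⊆ rest ++ keys L → ⊢ (conj L ⊃ A₀) ⊎ Countermodel A₀
enumerate A₀ decide L []         cov = Leaf.leaf-decision A₀ L cov decide
enumerate A₀ decide L (a ∷ rest) cov
  with enumerate A₀ decide ((a , true) ∷ L) rest (⊆-shift a rest (keys L) cov)
     | enumerate A₀ decide ((a , false) ∷ L) rest (⊆-shift a rest (keys L) cov)
... | inj₂ cm | _        = inj₂ cm
... | inj₁ _  | inj₂ cm  = inj₂ cm
... | inj₁ ⊢a | inj₁ ⊢¬a = inj₁ (⊃-cases ⊢a ⊢¬a)

decide : ∀ n A → depth A < n → ⊢ A ⊎ Countermodel A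
decide (suc n) A (s≤s depth≤n) =
  Sum.map₁ (mp ⊢⊤ᶠ) (enumerate A (λ B B< → decide n B (<-≤-trans B< depth≤n)) [] (closure A) (xs⊆xs++ys _ _))

mainTheorem16 : (A : Fml) → Dec (⊢ A)
mainTheorem16 A = Sum.[ yes , no ∘ countermodel-unprovable ]′ (decide (suc (depth A)) A ≤-refl)
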